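{- Let $k\ge 6$ and $n\ge 2k-2$, and let $G\in\mathfrak{Gr}(n,k)$. Then $G$ contains a triangle.
   Context: All graphs are finite, simple and undirected. For a graph $G=(V,E)$ and $x\in V$, $N[x]=\{x\}\cup\{y: xy\in E\}$. A set $C\subseteq V$ is identifying if $N[x]\cap C\ne\emptyset$ for every $x\in V$ and $N[x]\cap C\neq N[y]\cap C$ for all distinct $x,y\in V$. For $n\ge k\ge1$, $\mathfrak{Gr}(n,k)$ is the set of graphs on $n$ vertices in which every $k$-element subset of vertices is identifying. -}

module Defs where

open import Data.Nat using (ℕ)
open import Data.Bool using (Bool; true; false; _∨_; T)
open import Data.Fin using (Fin)
open import Data.Fin.Properties using (_≟_)
open import Data.Fin.Subset using (Subset; _∈_; ∣_∣)
open import Data.Product using (Σ; ∃; _×_; _,_)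
open import Relation.Binary.PropositionalEquality using (_≡_)
open import Relation.Nullary using (¬_; does)

record Graph (n : ℕ) : Set where
  field
    adj      : Fin n → Fin n → Bool
    symmetric  : ∀ x y → adj x y ≡ adj y x
    irreflexive : ∀ x → adj x x ≡ false
open Graph public

InN : ∀ {n} → Graph n → Fin n → Fin n → Set
InN G x y = T (does (y ≟ x) ∨ adj G x y)

Dominated : ∀ {n} → Graph n → Subset n → Fin n → Set
Dominated G C x = ∃ λ c → c ∈ C × InN G x c

Separated : ∀ {n} → Graph n → Subset n → Fin n → Fin n → Set
Separated G C x y =
  ¬ (∀ c → c ∈ C → ((InN G x c → InN G y c) × (InN G y c → InN G x c)))

Identifying : ∀ {n} → Graph n → Subset n → Set
Identifying G C =
  (∀ x → Dominated G C x) × (∀ x y → ¬ x ≡ y → Separated G C x y)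

InGr : (n k : ℕ) → Graph n → Set
InGr n k G = ∀ (C : Subset n) → ∣ C ∣ ≡ k → Identifying G C

HasTriangle : ∀ {n} → Graph n → Set
HasTriangle G = ∃ λ x → ∃ λ y → ∃ λ z →
  T (adj G x y) × T (adj G y z) × T (adj G x z)

module Submission where

-- Fix a vertex x of a triangle-free G ∈ Gr(n,k) and let F = V ∖ N[x] ('far').  As every
-- k-set is identifying, |F| < k, |N[y]| > n − k for every y, and |N[y] Δ N[z]| > n − k for
-- y ≠ z.  For a neighbour y of x, triangle-freeness puts N[y] inside {x, y} ∪ F, so
-- V_y = F ∖ N[y] ('far∖N y') satisfies n + |V_y| ≤ 2k; for neighbours y ≠ z it puts
-- N[y] Δ N[z] inside {y, z} ∪ (V_y Δ V_z).  When n ≥ 2k − 2 and k ≥ 6 these bounds force the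
-- sets V_y to be pairwise disjoint and x to have at least four neighbours; four pairwise
-- disjoint V_y inside F then contradict |F| < k.

open import Defs
open import Data.Bool using (Bool; true; false; _∨_; _∧_; not; _xor_; T)
open import Data.Bool.Properties using (T-∧)
open import Data.Empty renaming (⊥ to ⊥₀) using (⊥-elim)
open import Data.Fin using (Fin; zero; suc; fromℕ<)
open import Data.Fin.Patterns using (0F; 1F; 2F; 3F)
open import Data.Fin.Properties using (_≟_; any?; suc-injective)
open import Data.Fin.Subset using (Subset; _∈_; ∣_∣; inside; outside; ⊥)
open import Data.Fin.Subset.Properties using (∉⊥; ∣⊥∣≡0)
open import Data.List using (_∷_; [])
open import Data.Nat
  using (ℕ; zero; suc; _+_; _*_; _∸_; _≤_; _<_; z≤n; s≤s; s≤s⁻¹; _≤?_)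
open import Data.Nat.Properties hiding (_≟_; suc-injective)
open import Data.Nat.Tactic.RingSolver using (solve)
open import Algebra.Properties.Semiring.Sum +-*-semiring
  using (sum; sum-syntax; ∑-distrib-+; sum-cong-≗; *-distribˡ-sum; sum-replicate-zero)
open import Data.Product using (Σ; ∃; _×_; _,_; proj₁; proj₂)
open import Data.Vec.Base as Vec using (here; there)
open import Function using (_∘_; Equivalence)
open import Function.Definitions using (Injective)
open import Relation.Binary.PropositionalEquality
open import Relation.Nullary using (¬_; Dec; does; yes; no)
open import Relation.Nullary.Decidable using (T?; _×-dec_)

T-not-does : ∀ {A : Set} (a? : Dec A) → T (not (does a?)) → ¬ A
T-not-does (no ¬a) _ = ¬a

T-not⇒¬T : ∀ {b} → T (not b) → ¬ T b
T-not⇒¬T {false} _ ()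

¬T⇒T-not : ∀ {b} → ¬ T b → T (not b)
¬T⇒T-not {false} _  = _
¬T⇒T-not {true}  ¬t = ¬t _

𝟙 : Bool → ℕ
𝟙 true  = 1
𝟙 false = 0

count : ∀ {n} → (Fin n → Bool) → ℕ
count {n} p = ∑[ i < n ] 𝟙 (p i)

∑-mono : ∀ {n} {f g : Fin n → ℕ} → (∀ i → f i ≤ g i) → sum f ≤ sum g
∑-mono {zero}  f≤g = z≤n
∑-mono {suc n} f≤g = +-mono-≤ (f≤g zero) (∑-mono (f≤g ∘ suc))

count-mono : ∀ {n} {p q : Fin n → Bool} → (∀ i → T (p i) → T (q i)) → count p ≤ count q
count-mono p⊆q = ∑-mono (λ i → 𝟙-mono (p⊆q i))
  where
  𝟙-mono : ∀ {a b} → (T a → T b) → 𝟙 a ≤ 𝟙 b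
  𝟙-mono {false}         _   = z≤n
  𝟙-mono {true}  {true}  _   = ≤-refl
  𝟙-mono {true}  {false} a⇒b = ⊥-elim (a⇒b _)

count-∨ : ∀ {n} (p q : Fin n → Bool) → count (λ i → p i ∨ q i) ≤ count p + count q
count-∨ {n} p q = begin
  count (λ i → p i ∨ q i)       ≤⟨ ∑-mono (λ i → 𝟙-∨ (p i) (q i)) ⟩
  ∑[ i < n ] (𝟙 (p i) + 𝟙 (q i)) ≡⟨ ∑-distrib-+ (𝟙 ∘ p) (𝟙 ∘ q) ⟩
  count p + count q             ∎
  where
  open ≤-Reasoning
  𝟙-∨ : ∀ a b → 𝟙 (a ∨ b) ≤ 𝟙 a + 𝟙 b
  𝟙-∨ true  _ = s≤s z≤n
  𝟙-∨ false _ = ≤-refl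

count-∧-∧not : ∀ {n} (p q : Fin n → Bool) →
  count (λ i → p i ∧ q i) + count (λ i → p i ∧ not (q i)) ≡ count p
count-∧-∧not {n} p q = begin
  count (λ i → p i ∧ q i) + count (λ i → p i ∧ not (q i))
    ≡⟨ ∑-distrib-+ (λ i → 𝟙 (p i ∧ q i)) (λ i → 𝟙 (p i ∧ not (q i))) ⟨
  ∑[ i < n ] (𝟙 (p i ∧ q i) + 𝟙 (p i ∧ not (q i)))
    ≡⟨ sum-cong-≗ (λ i → split (p i) (q i)) ⟩
  count p ∎
  where
  open ≡-Reasoning
  split : ∀ a b → 𝟙 (a ∧ b) + 𝟙 (a ∧ not b) ≡ 𝟙 a
  split true  true  = refl
  split true  false = refl
  split false _     = refl

count-xor : ∀ {n} (p q : Fin n → Bool) →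
  count (λ i → p i xor q i) + 2 * count (λ i → p i ∧ q i) ≡ count p + count q
count-xor {n} p q = begin
  count (λ i → p i xor q i) + 2 * count (λ i → p i ∧ q i)
    ≡⟨ cong (count (λ i → p i xor q i) +_) (*-distribˡ-sum 2 (λ i → 𝟙 (p i ∧ q i))) ⟩
  count (λ i → p i xor q i) + ∑[ i < n ] (2 * 𝟙 (p i ∧ q i))
    ≡⟨ ∑-distrib-+ (λ i → 𝟙 (p i xor q i)) (λ i → 2 * 𝟙 (p i ∧ q i)) ⟨
  ∑[ i < n ] (𝟙 (p i xor q i) + 2 * 𝟙 (p i ∧ q i))
    ≡⟨ sum-cong-≗ (λ i → xor-∧ (p i) (q i)) ⟩
  ∑[ i < n ] (𝟙 (p i) + 𝟙 (q i))
    ≡⟨ ∑-distrib-+ (𝟙 ∘ p) (𝟙 ∘ q) ⟩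
  count p + count q ∎
  where
  open ≡-Reasoning
  xor-∧ : ∀ a b → 𝟙 (a xor b) + 2 * 𝟙 (a ∧ b) ≡ 𝟙 a + 𝟙 b
  xor-∧ true  true  = refl
  xor-∧ true  false = refl
  xor-∧ false true  = refl
  xor-∧ false false = refl

count-true : ∀ n → count {n} (λ _ → true) ≡ n
count-true zero    = refl
count-true (suc n) = cong suc (count-true n)

count-false : ∀ n → count {n} (λ _ → false) ≡ 0
count-false n = sum-replicate-zero n

count-not : ∀ {n} (p : Fin n → Bool) → count p + count (λ i → not (p i)) ≡ n
count-not {n} p = trans (count-∧-∧not (λ _ → true) p) (count-true n)

count-≟ : ∀ {n} (v : Fin n) → count (λ i → does (i ≟ v)) ≡ 1
count-≟ {suc n} zero    = cong suc (count-false n)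
count-≟ {suc n} (suc v) = count-≟ v

count-witness : ∀ {n} {p : Fin n → Bool} → 0 < count p → ∃ λ i → T (p i)
count-witness {n} {p} 0<count with any? (λ i → T? (p i))
... | yes witness = witness
... | no  none    = ⊥-elim (<-irrefl refl (begin-strict
  0                       <⟨ 0<count ⟩
  count p                 ≤⟨ count-mono (λ i pᵢ → ⊥-elim (none (i , pᵢ))) ⟩
  count {n} (λ _ → false) ≡⟨ count-false n ⟩
  0                       ∎))
  where open ≤-Reasoning

subset-of-size : ∀ {n} k (p : Fin n → Bool) → k ≤ count p →
  Σ (Subset n) λ C → ∣ C ∣ ≡ k × (∀ c → c ∈ C → T (p c))
subset-of-size {n}     zero    p _ = ⊥ , ∣⊥∣≡0 n , λ c c∈⊥ → ⊥-elim (∉⊥ c∈⊥)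
subset-of-size {suc n} (suc k) p k<count with p zero in p₀
... | true with subset-of-size k (p ∘ suc) (s≤s⁻¹ k<count)
...   | C , ∣C∣≡k , C⊆p = inside Vec.∷ C , cong suc ∣C∣≡k , ⊆p
  where
  ⊆p : ∀ c → c ∈ inside Vec.∷ C → T (p c)
  ⊆p zero    here      = subst T (sym p₀) _
  ⊆p (suc c) (there c∈C) = C⊆p c c∈C
subset-of-size {suc n} (suc k) p k<count | false with subset-of-size (suc k) (p ∘ suc) k<count
...   | C , ∣C∣≡k , C⊆p = outside Vec.∷ C , ∣C∣≡k , ⊆p
  where
  ⊆p : ∀ c → c ∈ outside Vec.∷ C → T (p c)
  ⊆p (suc c) (there c∈C) = C⊆p c c∈C

count≤suc-count-without : ∀ {n} (p : Fin n → Bool) (v : Fin n) →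
  count p ≤ suc (count (λ u → p u ∧ not (does (u ≟ v))))
count≤suc-count-without {n} p v = begin
  count p                                    ≤⟨ count-mono p⊆v∪p∖v ⟩
  count (λ u → does (u ≟ v) ∨ p∖v u)         ≤⟨ count-∨ (λ u → does (u ≟ v)) p∖v ⟩
  count (λ u → does (u ≟ v)) + count p∖v     ≡⟨ cong (_+ count p∖v) (count-≟ v) ⟩
  suc (count p∖v)                            ∎
  where
  open ≤-Reasoning
  p∖v : Fin n → Bool
  p∖v u = p u ∧ not (does (u ≟ v))
  p⊆v∪p∖v : ∀ u → T (p u) → T (does (u ≟ v) ∨ p∖v u)
  p⊆v∪p∖v u pᵤ with u ≟ v
  ... | yes _ = _
  ... | no  _ = Equivalence.from T-∧ (pᵤ , _)

count≤2+count : ∀ {n} (p q : Fin n → Bool) (a b : Fin n) →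
  (∀ c → T (p c) → T (does (c ≟ a) ∨ (does (c ≟ b) ∨ q c))) → count p ≤ 2 + count q
count≤2+count p q a b p⊆ab∪q = begin
  count p
    ≤⟨ count-mono p⊆ab∪q ⟩
  count (λ c → does (c ≟ a) ∨ (does (c ≟ b) ∨ q c))
    ≤⟨ count-∨ (λ c → does (c ≟ a)) (λ c → does (c ≟ b) ∨ q c) ⟩
  count (λ c → does (c ≟ a)) + count (λ c → does (c ≟ b) ∨ q c)
    ≤⟨ +-mono-≤ (≤-reflexive (count-≟ a)) (count-∨ (λ c → does (c ≟ b)) q) ⟩
  1 + (count (λ c → does (c ≟ b)) + count q)
    ≡⟨ cong (λ m → 1 + (m + count q)) (count-≟ b) ⟩
  2 + count q ∎
  where open ≤-Reasoning

distinct-elements : ∀ {n} m (p : Fin n → Bool) → m ≤ count p →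
  Σ (Fin m → Fin n) λ f → Injective _≡_ _≡_ f × (∀ i → T (p (f i)))
distinct-elements zero    p _ = (λ ()) , (λ {}) , (λ ())
distinct-elements {n} (suc m) p m<count
  with v , pᵥ ← count-witness (≤-trans (s≤s z≤n) m<count)
  with f , f-inj , pf ← distinct-elements m (λ u → p u ∧ not (does (u ≟ v)))
                          (s≤s⁻¹ (≤-trans m<count (count≤suc-count-without p v)))
  = g , g-inj , pg
  where
  f≢v : ∀ i → f i ≢ v
  f≢v i = T-not-does (f i ≟ v) (proj₂ (Equivalence.to T-∧ (pf i)))
  g : Fin (suc m) → Fin n
  g zero    = v
  g (suc i) = f i
  g-inj : Injective _≡_ _≡_ g
  g-inj {zero}  {zero}  _  = refl
  g-inj {zero}  {suc j} eq = ⊥-elim (f≢v j (sym eq))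
  g-inj {suc i} {zero}  eq = ⊥-elim (f≢v i eq)
  g-inj {suc i} {suc j} eq = cong suc (f-inj eq)
  pg : ∀ i → T (p (g i))
  pg zero    = pᵥ
  pg (suc i) = proj₁ (Equivalence.to T-∧ (pf i))

∑-count-disjoint≤count : ∀ {n m} (P : Fin m → Fin n → Bool) (q : Fin n → Bool) →
  (∀ {i j} → i ≢ j → ∀ c → T (P i c) → T (P j c) → ⊥₀) →
  (∀ i c → T (P i c) → T (q c)) →
  ∑[ i < m ] count (P i) ≤ count q
∑-count-disjoint≤count {m = zero}  P q _        _   = z≤n
∑-count-disjoint≤count {m = suc m} P q disjoint P⊆q = begin
  count (P zero) + ∑[ i < m ] count (P (suc i))
    ≤⟨ +-mono-≤ (count-mono (λ c P₀c → Equivalence.from T-∧ (P⊆q zero c P₀c , P₀c)))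
                (∑-count-disjoint≤count (P ∘ suc) (λ c → q c ∧ not (P zero c))
                   (λ i≢j → disjoint (i≢j ∘ suc-injective)) P∘suc⊆q∖P₀) ⟩
  count (λ c → q c ∧ P zero c) + count (λ c → q c ∧ not (P zero c))
    ≡⟨ count-∧-∧not q (P zero) ⟩
  count q ∎
  where
  open ≤-Reasoning
  P∘suc⊆q∖P₀ : ∀ i c → T (P (suc i) c) → T (q c ∧ not (P zero c))
  P∘suc⊆q∖P₀ i c Pᵢc =
    Equivalence.from T-∧
      (P⊆q (suc i) c Pᵢc , ¬T⇒T-not (λ P₀c → disjoint (λ ()) c P₀c Pᵢc))

n<count+k-if-no-k-subset-outside : ∀ {n} k (p : Fin n → Bool) →
  (∀ C → ∣ C ∣ ≡ k → ¬ (∀ c → c ∈ C → T (not (p c)))) → n < count p + k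
n<count+k-if-no-k-subset-outside {n} k p no-k-subset with k ≤? count (λ c → not (p c))
... | yes k≤count with C , ∣C∣≡k , C⊆∁p ← subset-of-size k (λ c → not (p c)) k≤count
  = ⊥-elim (no-k-subset C ∣C∣≡k C⊆∁p)
... | no  k≰count = begin-strict
  n                                      ≡⟨ count-not p ⟨
  count p + count (λ c → not (p c))      <⟨ +-monoʳ-< (count p) (≰⇒> k≰count) ⟩
  count p + k                            ∎
  where open ≤-Reasoning

N : ∀ {n} → Graph n → Fin n → Fin n → Bool
N G x c = does (c ≟ x) ∨ adj G x c

module InGrProperties {n} k (G : Graph n) (G∈Gr : InGr n k G) where

  n<count-N+k : ∀ x → n < count (N G x) + k
  n<count-N+k x = n<count+k-if-no-k-subset-outside k (N G x) λ C ∣C∣≡k C⊆∁N →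
    let c , c∈C , c∈N = proj₁ (G∈Gr C ∣C∣≡k) x in T-not⇒¬T (C⊆∁N c c∈C) c∈N

  n<count-Δ+k : ∀ y z → y ≢ z → n < count (λ c → N G y c xor N G z c) + k
  n<count-Δ+k y z y≢z = n<count+k-if-no-k-subset-outside k _ λ C ∣C∣≡k C⊆∁Δ →
    proj₂ (G∈Gr C ∣C∣≡k) y z y≢z λ c c∈C → not-xor⇒⇔ (C⊆∁Δ c c∈C)
    where
    not-xor⇒⇔ : ∀ {a b} → T (not (a xor b)) → (T a → T b) × (T b → T a)
    not-xor⇒⇔ {true}  {true}  _ = (λ t → t) , (λ t → t)
    not-xor⇒⇔ {false} {false} _ = (λ t → t) , (λ t → t)

far∖N-arith : ∀ {n k a b v f} →
  n < a + k → a ≤ 2 + b → b + v ≡ f → f < k → n + v ≤ k + k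
far∖N-arith {n} {k} {a} {b} {v} {f} n<a+k a≤2+b b+v≡f f<k = s≤s⁻¹ (begin
  suc n + v         ≤⟨ +-monoˡ-≤ v n<a+k ⟩
  a + k + v         ≤⟨ +-monoˡ-≤ v (+-monoˡ-≤ k a≤2+b) ⟩
  2 + b + k + v     ≡⟨ solve (b ∷ k ∷ v ∷ []) ⟩
  2 + (b + v) + k   ≡⟨ cong (λ m → 2 + m + k) b+v≡f ⟩
  2 + f + k         ≤⟨ +-monoˡ-≤ k (+-monoʳ-≤ 1 f<k) ⟩
  suc (k + k)       ∎)
  where open ≤-Reasoning

Δ-arith : ∀ {n k δ w a b I} → n < δ + k → δ ≤ 2 + w → w + 2 * I ≡ a + b →
  suc n + 2 * I ≤ 2 + (a + b) + k
Δ-arith {n} {k} {δ} {w} {a} {b} {I} n<δ+k δ≤2+w w+2I≡a+b = begin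
  suc n + 2 * I         ≤⟨ +-monoˡ-≤ (2 * I) n<δ+k ⟩
  δ + k + 2 * I         ≤⟨ +-monoˡ-≤ (2 * I) (+-monoˡ-≤ k δ≤2+w) ⟩
  2 + w + k + 2 * I     ≡⟨ solve (w ∷ k ∷ I ∷ []) ⟩
  2 + (w + 2 * I) + k   ≡⟨ cong (λ m → 2 + m + k) w+2I≡a+b ⟩
  2 + (a + b) + k       ∎
  where open ≤-Reasoning

disjoint-arith : ∀ {n k a b I} → suc n + 2 * I ≤ 2 + (a + b) + k →
  n + a ≤ k + k → n + b ≤ k + k → 2 * k ≤ 2 + n → 6 ≤ k → I ≡ 0
disjoint-arith {I = zero} _ _ _ _ _ = refl
disjoint-arith {n} {k} {a} {b} {suc J} pair n+a≤2k n+b≤2k 2k≤2+n 6≤k =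
  ⊥-elim (<-irrefl refl (begin-strict
  5 * k + 6                       <⟨ +-monoʳ-< (5 * k) (s≤s 6≤k) ⟩
  5 * k + suc k                   ≡⟨ solve (k ∷ []) ⟩
  3 * (2 * k) + 1                 ≤⟨ +-monoˡ-≤ 1 (*-monoʳ-≤ 3 2k≤2+n) ⟩
  3 * (2 + n) + 1                 ≡⟨ solve (n ∷ []) ⟩
  4 + n + n + (suc n + 2)         ≤⟨ +-monoʳ-≤ (4 + n + n)
                                       (+-monoʳ-≤ (suc n) (*-monoʳ-≤ 2 (s≤s z≤n))) ⟩
  4 + n + n + (suc n + 2 * suc J) ≤⟨ +-monoʳ-≤ (4 + n + n) pair ⟩
  4 + n + n + (2 + (a + b) + k)   ≡⟨ solve (n ∷ a ∷ b ∷ k ∷ []) ⟩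
  6 + (n + a) + (n + b) + k       ≤⟨ +-monoˡ-≤ k (+-mono-≤ (+-monoʳ-≤ 6 n+a≤2k) n+b≤2k) ⟩
  6 + (k + k) + (k + k) + k       ≡⟨ solve (k ∷ []) ⟩
  5 * k + 6                       ∎))
  where open ≤-Reasoning

degree-arith : ∀ {n k c d} → n < c + k → c ≤ 1 + d → 2 * k ≤ 2 + n → 6 ≤ k → 4 ≤ d
degree-arith {n} {k} {c} {d} n<c+k c≤1+d 2k≤2+n 6≤k = +-cancelˡ-≤ (2 + k) 4 d (begin
  2 + k + 4         ≡⟨ solve (k ∷ []) ⟩
  k + 6             ≤⟨ +-monoʳ-≤ k 6≤k ⟩
  k + k             ≡⟨ solve (k ∷ []) ⟩
  2 * k             ≤⟨ 2k≤2+n ⟩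
  2 + n             ≤⟨ +-monoʳ-≤ 1 n<c+k ⟩
  1 + (c + k)       ≤⟨ +-monoʳ-≤ 1 (+-monoˡ-≤ k c≤1+d) ⟩
  1 + (1 + d + k)   ≡⟨ solve (d ∷ k ∷ []) ⟩
  2 + k + d         ∎)
  where open ≤-Reasoning

no-four-neighbours-arith : ∀ {n k a b c d f} →
  suc n ≤ 2 + (a + b) + k → suc n ≤ 2 + (c + d) + k →
  a + (b + (c + (d + 0))) ≤ f → f < k → 2 * k ≤ 2 + n → 6 ≤ k → ⊥₀
no-four-neighbours-arith {n} {k} {a} {b} {c} {d} {f} ab cd a+b+c+d≤f f<k 2k≤2+n 6≤k =
  <-irrefl refl (begin-strict
  2 * (2 * k) + 6                          ≤⟨ +-mono-≤ (*-monoʳ-≤ 2 2k≤2+n) 6≤k ⟩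
  2 * (2 + n) + k                          ≡⟨ solve (n ∷ k ∷ []) ⟩
  2 + (suc n + suc n) + k                  ≤⟨ +-monoˡ-≤ k (+-monoʳ-≤ 2 (+-mono-≤ ab cd)) ⟩
  2 + ((2 + (a + b) + k) + (2 + (c + d) + k)) + k ≡⟨ solve (a ∷ b ∷ c ∷ d ∷ k ∷ []) ⟩
  6 + (a + (b + (c + (d + 0)))) + 3 * k    ≤⟨ +-monoˡ-≤ (3 * k) (+-monoʳ-≤ 6 a+b+c+d≤f) ⟩
  6 + f + 3 * k                            <⟨ +-monoˡ-< (3 * k) (+-monoʳ-< 6 f<k) ⟩
  6 + k + 3 * k                            ≡⟨ solve (k ∷ []) ⟩
  2 * (2 * k) + 6                          ∎)
  where open ≤-Reasoning

module TriangleFree {n} (G : Graph n) (triangle-free : ¬ HasTriangle G) (x : Fin n) where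

  far : Fin n → Bool
  far c = not (N G x c)

  far∖N : Fin n → Fin n → Bool
  far∖N y c = far c ∧ not (N G y c)

  module _ {y} (x∼y : T (adj G x y)) where

    N-nbr⊆ : ∀ c → T (N G y c) → T (does (c ≟ x) ∨ (does (c ≟ y) ∨ (far c ∧ N G y c)))
    N-nbr⊆ c c∈N with c ≟ x | c ≟ y
    ... | yes _ | _     = _
    ... | no  _ | yes _ = _
    ... | no  _ | no  _ with adj G x c in x∼c
    ...   | true  = ⊥-elim (triangle-free (x , y , c , x∼y , c∈N , subst T (sym x∼c) _))
    ...   | false = c∈N

    count-N≤ : count (N G y) ≤ 2 + count (λ c → far c ∧ N G y c)
    count-N≤ = count≤2+count _ _ x y N-nbr⊆

  module _ {y z} (x∼y : T (adj G x y)) (x∼z : T (adj G x z)) where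

    Δ⊆ : ∀ c → T (N G y c xor N G z c) →
      T (does (c ≟ y) ∨ (does (c ≟ z) ∨ (far∖N y c xor far∖N z c)))
    Δ⊆ c c∈Δ with c ≟ y | c ≟ z
    ... | yes _ | _     = _
    ... | no  _ | yes _ = _
    ... | no  _ | no  _ with c ≟ x
    ...   | yes refl =
      ⊥-elim (xor-both c∈Δ (subst T (symmetric G x y) x∼y) (subst T (symmetric G x z) x∼z))
      where
      xor-both : ∀ {a b} → T (a xor b) → T a → T b → ⊥₀
      xor-both {true} {true} ()
    ...   | no  _ with adj G x c in x∼c | adj G y c in y∼c | adj G z c in z∼c
    -- The clauses left out have c∈Δ : T false.
    ...     | true  | true  | _     =
      ⊥-elim (triangle-free (x , y , c , x∼y , subst T (sym y∼c) _ , subst T (sym x∼c) _))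
    ...     | true  | false | true  =
      ⊥-elim (triangle-free (x , z , c , x∼z , subst T (sym z∼c) _ , subst T (sym x∼c) _))
    ...     | false | true  | false = _
    ...     | false | false | true  = _

    count-Δ≤ :
      count (λ c → N G y c xor N G z c) ≤ 2 + count (λ c → far∖N y c xor far∖N z c)
    count-Δ≤ = count≤2+count _ _ y z Δ⊆

  module _ {k} (G∈Gr : InGr n k G) where

    open InGrProperties k G G∈Gr

    count-far<k : count far < k
    count-far<k = +-cancelˡ-< (count (N G x)) _ _ (begin-strict
      count (N G x) + count far ≡⟨ count-not (N G x) ⟩
      n                         <⟨ n<count-N+k x ⟩
      count (N G x) + k         ∎)
      where open ≤-Reasoning

    n+count-far∖N≤2k : ∀ {y} → T (adj G x y) → n + count (far∖N y) ≤ k + k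
    n+count-far∖N≤2k {y} x∼y = far∖N-arith (n<count-N+k y) (count-N≤ x∼y)
      (count-∧-∧not far (N G y)) count-far<k

    Δ-bound : ∀ {y z} → T (adj G x y) → T (adj G x z) → y ≢ z →
      suc n + 2 * count (λ c → far∖N y c ∧ far∖N z c)
        ≤ 2 + (count (far∖N y) + count (far∖N z)) + k
    Δ-bound {y} {z} x∼y x∼z y≢z =
      Δ-arith {a = count (far∖N y)} {b = count (far∖N z)}
              {I = count (λ c → far∖N y c ∧ far∖N z c)}
        (n<count-Δ+k y z y≢z) (count-Δ≤ x∼y x∼z) (count-xor (far∖N y) (far∖N z))

    module _ (6≤k : 6 ≤ k) (2k≤2+n : 2 * k ≤ 2 + n) where

      far∖N-disjoint : ∀ {y z} → T (adj G x y) → T (adj G x z) → y ≢ z →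
        ∀ c → T (far∖N y c) → T (far∖N z c) → ⊥₀
      far∖N-disjoint {y} {z} x∼y x∼z y≢z c c∈y c∈z = 1+n≰n (begin
        1                                            ≡⟨ count-≟ c ⟨
        count (λ u → does (u ≟ c))                   ≤⟨ count-mono c∈both ⟩
        count (λ u → far∖N y u ∧ far∖N z u)          ≡⟨ overlap≡0 ⟩
        0                                            ∎)
        where
        open ≤-Reasoning
        c∈both : ∀ u → T (does (u ≟ c)) → T (far∖N y u ∧ far∖N z u)
        c∈both u u≡c with u ≟ c
        ... | yes refl = Equivalence.from T-∧ (c∈y , c∈z)
        overlap≡0 : count (λ u → far∖N y u ∧ far∖N z u) ≡ 0
        overlap≡0 = disjoint-arith (Δ-bound x∼y x∼z y≢z)
          (n+count-far∖N≤2k x∼y) (n+count-far∖N≤2k x∼z) 2k≤2+n 6≤k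

      4≤degree : 4 ≤ count (adj G x)
      4≤degree = degree-arith (n<count-N+k x) count-N≤1+degree 2k≤2+n 6≤k
        where
        count-N≤1+degree : count (N G x) ≤ 1 + count (adj G x)
        count-N≤1+degree = ≤-trans (count-∨ (λ c → does (c ≟ x)) (adj G x))
                                   (≤-reflexive (cong (_+ count (adj G x)) (count-≟ x)))

      no-four-neighbours :
        (f : Fin 4 → Fin n) → Injective _≡_ _≡_ f → (∀ i → T (adj G x (f i))) → ⊥₀
      no-four-neighbours f f-inj x∼f =
        no-four-neighbours-arith {a = v 0F} {b = v 1F} {c = v 2F} {d = v 3F}
          (pair 0F 1F (λ ())) (pair 2F 3F (λ ())) ∑≤count-far count-far<k 2k≤2+n 6≤k
        where
        v : Fin 4 → ℕ
        v i = count (far∖N (f i))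
        f≢ : ∀ {i j} → i ≢ j → f i ≢ f j
        f≢ i≢j = i≢j ∘ f-inj
        pair : ∀ i j → i ≢ j → suc n ≤ 2 + (v i + v j) + k
        pair i j i≢j = ≤-trans (m≤m+n (suc n) _) (Δ-bound (x∼f i) (x∼f j) (f≢ i≢j))
        ∑≤count-far : ∑[ i < 4 ] v i ≤ count far
        ∑≤count-far = ∑-count-disjoint≤count (far∖N ∘ f) far
          (λ i≢j → far∖N-disjoint (x∼f _) (x∼f _) (f≢ i≢j))
          (λ i c c∈far∖N → proj₁ (Equivalence.to T-∧ c∈far∖N))

      no-vertex : ⊥₀
      no-vertex = let f , f-inj , x∼f = distinct-elements 4 (adj G x) 4≤degree in
        no-four-neighbours f f-inj x∼f

triangle? : ∀ {n} (G : Graph n) → Dec (HasTriangle G)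
triangle? G = any? λ x → any? λ y → any? λ z →
  T? (adj G x y) ×-dec T? (adj G y z) ×-dec T? (adj G x z)

theorem20 : (k n : ℕ) → 6 ≤ k → 2 * k ∸ 2 ≤ n → (G : Graph n) →
    InGr n k G → HasTriangle G
theorem20 k n 6≤k 2k∸2≤n G G∈Gr with triangle? G
... | yes triangle      = triangle
... | no  triangle-free = ⊥-elim (TriangleFree.no-vertex G triangle-free vertex G∈Gr 6≤k 2k≤2+n)
  where
  2k≤2+n : 2 * k ≤ 2 + n
  2k≤2+n = ≤-trans (m≤n+m∸n (2 * k) 2) (+-monoʳ-≤ 2 2k∸2≤n)
  vertex : Fin n
  vertex = fromℕ< (+-cancelˡ-< 2 0 n
    (≤-trans (≤-trans (m≤m+n 3 9) (*-monoʳ-≤ 2 6≤k)) 2k≤2+n))
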